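{- Let $\Gamma$ be a signed graph with a cut vertex $w$ such that $\Gamma=\Gamma_1\cdot\Gamma_2$ is the coalescence of signed graphs $\Gamma_1$ and $\Gamma_2$ at $w$. Then $\eta(\Gamma)=\eta(\Gamma_1)+\eta(\Gamma_2)-1$.
   Context: A signed graph $\Gamma=(G,\sigma)$ is a simple graph $G$ with a sign function $\sigma:E(G)\to\{ -1,+1\}$. The net Laplacian matrix is $L^{\pm}(\Gamma)=D^{\pm}(\Gamma)-A(\Gamma)$, where $D^{\pm}(\Gamma)$ is the diagonal matrix of net-degrees $d^{\pm}(v)=d^+(v)-d^-(v)$ (numbers of positive minus negative neighbours) and $A(\Gamma)$ is the signed adjacency matrix. $\eta(\Gamma)$ is the multiplicity of $0$ as an eigenvalue of $L^{\pm}(\Gamma)$. The coalescence $\Gamma_1\cdot\Gamma_2$ is obtained from the disjoint union of $\Gamma_1$ and $\Gamma_2$ by identifying a vertex $u$ of $\Gamma_1$ with a vertex $v$ of $\Gamma_2$ into a single vertex $w$: its vertex set is $V(\Gamma_1-u)\,\dot\cup\,V(\Gamma_2-v)\,\dot\cup\,\{w\}$, two vertices are adjacent (with the same sign) if adjacent in $\Gamma_1$ or $\Gamma_2$, and $w$ is adjacent to the neighbours of $u$ in $\Gamma_1$ and of $v$ in $\Gamma_2$, with the corresponding signs. -}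

module Defs where

open import Data.Nat using (ℕ; zero; suc; _+_)
open import Data.Fin using (Fin; zero; suc; punchIn; splitAt; _≟_)
open import Data.Sum using (_⊎_; inj₁; inj₂)
open import Data.Rational using (ℚ; 0ℚ; 1ℚ; -_) renaming (_+_ to _+ℚ_; _*_ to _*ℚ_; _-_ to _-ℚ_)
open import Relation.Binary.PropositionalEquality using (_≡_; refl)
open import Data.Product using (Σ; _×_; _,_)
open import Relation.Nullary using (¬_; yes; no)

data Edge : Set where
  none pos neg : Edge

edgeVal : Edge → ℚ
edgeVal none = 0ℚ
edgeVal pos  = 1ℚ
edgeVal neg  = - 1ℚ

record SignedGraph (n : ℕ) : Set where
  field
    adj   : Fin n → Fin n → Edge
    symm  : ∀ i j → adj i j ≡ adj j i
    loopless : ∀ i → adj i i ≡ none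
open SignedGraph public

Σ[_] : ∀ {n} → (Fin n → ℚ) → ℚ
Σ[_] {zero}  f = 0ℚ
Σ[_] {suc n} f = f zero +ℚ Σ[_] (λ i → f (suc i))

A : ∀ {n} → SignedGraph n → Fin n → Fin n → ℚ
A Γ i j = edgeVal (adj Γ i j)

netDeg : ∀ {n} → SignedGraph n → Fin n → ℚ
netDeg Γ i = Σ[ (λ j → A Γ i j) ]

netLap : ∀ {n} → SignedGraph n → Fin n → Fin n → ℚ
netLap Γ i j with i ≟ j
... | yes _ = netDeg Γ i -ℚ A Γ i j
... | no  _ = 0ℚ -ℚ A Γ i j

_·_ : ∀ {n} → (Fin n → Fin n → ℚ) → (Fin n → ℚ) → Fin n → ℚ
(M · x) i = Σ[ (λ j → M i j *ℚ x j) ]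

InKernel : ∀ {n} → (Fin n → Fin n → ℚ) → (Fin n → ℚ) → Set
InKernel M x = ∀ i → (M · x) i ≡ 0ℚ

LinIndep : ∀ {n k} → (Fin k → Fin n → ℚ) → Set
LinIndep {n} {k} vs =
  (c : Fin k → ℚ) → (∀ x → Σ[ (λ i → c i *ℚ vs i x) ] ≡ 0ℚ) → ∀ i → c i ≡ 0ℚ

-- "The multiplicity of the eigenvalue 0 of M is k", i.e. dim ker M = k
-- (M is symmetric, so geometric = algebraic multiplicity): there are k linearly
-- independent kernel vectors, and no k+1 kernel vectors are linearly independent.
Nullity : ∀ {n} → (Fin n → Fin n → ℚ) → ℕ → Set
Nullity {n} M k =
  (Σ (Fin k → Fin n → ℚ) λ vs → (∀ i → InKernel M (vs i)) × LinIndep vs)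
  × ((vs : Fin (suc k) → Fin n → ℚ) → (∀ i → InKernel M (vs i)) → ¬ LinIndep vs)

η≡ : ∀ {n} → SignedGraph n → ℕ → Set
η≡ Γ k = Nullity (netLap Γ) k

-- The coalescence lives on Fin (suc (m + n)): vertex zero is w,
-- suc (i ↑ˡ n) is the vertex punchIn u i of Γ₁ − u,
-- suc (m ↑ʳ j) is the vertex punchIn v j of Γ₂ − v.
data CVertex (m n : ℕ) : Set where
  wv : CVertex m n
  lv : Fin m → CVertex m n
  rv : Fin n → CVertex m n

classify : ∀ {m n} → Fin (suc (m + n)) → CVertex m n
classify zero = wv
classify {m} (suc x) with splitAt m x
... | inj₁ i = lv i
... | inj₂ j = rv j

module _ {m n : ℕ} (Γ₁ : SignedGraph (suc m)) (u : Fin (suc m))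
                   (Γ₂ : SignedGraph (suc n)) (v : Fin (suc n)) where
  coalAdjC : CVertex m n → CVertex m n → Edge
  coalAdjC wv     wv     = none
  coalAdjC wv     (lv i) = adj Γ₁ u (punchIn u i)
  coalAdjC wv     (rv j) = adj Γ₂ v (punchIn v j)
  coalAdjC (lv i) wv     = adj Γ₁ (punchIn u i) u
  coalAdjC (rv j) wv     = adj Γ₂ (punchIn v j) v
  coalAdjC (lv i) (lv k) = adj Γ₁ (punchIn u i) (punchIn u k)
  coalAdjC (rv j) (rv k) = adj Γ₂ (punchIn v j) (punchIn v k)
  coalAdjC (lv _) (rv _) = none
  coalAdjC (rv _) (lv _) = none

  coalSymC : ∀ x y → coalAdjC x y ≡ coalAdjC y x
  coalSymC wv     wv     = refl
  coalSymC wv     (lv i) = symm Γ₁ u (punchIn u i)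
  coalSymC wv     (rv j) = symm Γ₂ v (punchIn v j)
  coalSymC (lv i) wv     = symm Γ₁ (punchIn u i) u
  coalSymC (rv j) wv     = symm Γ₂ (punchIn v j) v
  coalSymC (lv i) (lv k) = symm Γ₁ (punchIn u i) (punchIn u k)
  coalSymC (rv j) (rv k) = symm Γ₂ (punchIn v j) (punchIn v k)
  coalSymC (lv _) (rv _) = refl
  coalSymC (rv _) (lv _) = refl

  coalLoopC : ∀ x → coalAdjC x x ≡ none
  coalLoopC wv     = refl
  coalLoopC (lv i) = loopless Γ₁ (punchIn u i)
  coalLoopC (rv j) = loopless Γ₂ (punchIn v j)

  coalescence : SignedGraph (suc (m + n))
  coalescence = record
    { adj      = λ x y → coalAdjC (classify x) (classify y)
    ; symm     = λ x y → coalSymC (classify x) (classify y)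
    ; loopless = λ x → coalLoopC (classify x)
    }

-- The net Laplacian acts by (L±x)ᵢ = Σⱼ Aᵢⱼ (xᵢ − xⱼ), so constant vectors lie in its kernel and the
-- entries of L±x sum to zero. On the coalescence, the equation at a vertex of Γ₁ − u (resp. Γ₂ − v) is
-- the one of Γ₁ (resp. Γ₂), and the equation at w is the sum of those at u and v. Hence x lies in
-- ker L±(Γ) iff its restrictions to Γ₁ and Γ₂ lie in ker L±(Γ₁) and ker L±(Γ₂) (the equation at u,
-- resp. v, follows from the vanishing sum), and every such pair agreeing at u and v glues to a kernel
-- vector. Each kernel is spanned by the all-ones vector and its hyperplane section {y(u) = 0}, which
-- has dimension η − 1; so the all-ones vector together with the two glued section bases is a basis of
-- ker L±(Γ), of size 1 + (η₁ − 1) + (η₂ − 1). Dimensions are compared through Gaussian elimination over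
-- ℚ, which decides linear independence and yields the Steinitz bound.
module Submission where

open import Defs
open import Data.Nat using (ℕ; suc; _+_; _∸_)
open import Data.Fin using (Fin)

open import Data.Nat using (zero; _≤_; z≤n; s≤s)
import Data.Nat.Properties as ℕ
open import Data.Fin using (zero; suc; punchIn; punchOut; _↑ˡ_; _↑ʳ_; splitAt)
import Data.Fin as Fin
open import Data.Rational using (ℚ; 0ℚ; 1ℚ; -_; 1/_; NonZero; ≢-nonZero)
  renaming (_+_ to _+ℚ_; _*_ to _*ℚ_; _-_ to _-ℚ_)
open import Data.Rational.Properties
  using (_≟_; 1≢0; +-*-commutativeRing; +-*-ring; +-0-group; +-assoc; +-identityˡ; +-identityʳ; +-inverseʳ;
         *-assoc; *-comm; *-identityˡ; *-identityʳ; *-inverseˡ; *-zeroˡ; *-zeroʳ)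
open import Data.Fin.Properties
  using (all?; ¬∀⟶∃¬; punchIn-punchOut; punchInᵢ≢i; splitAt-↑ˡ; splitAt-↑ʳ; splitAt⁻¹-↑ˡ; splitAt⁻¹-↑ʳ)
open import Data.Vec.Functional using (_∷_; _++_; insertAt)
open import Data.Vec.Functional.Properties
  using (insertAt-lookup; insertAt-punchIn; insertAt-removeAt; lookup-++ˡ; lookup-++ʳ)
open import Data.Product using (Σ; ∃; _×_; _,_; proj₁; proj₂)
open import Data.Sum using (_⊎_; inj₁; inj₂)
open import Data.Empty using (⊥-elim)
open import Data.Maybe using (Maybe; just; nothing)
open import Function using (_∘_)
open import Level using (0ℓ)
open import Relation.Nullary using (¬_; yes; no)
open import Relation.Binary.PropositionalEquality
open import Tactic.RingSolver using (solve-∀)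
open import Tactic.RingSolver.Core.AlmostCommutativeRing using (AlmostCommutativeRing; fromCommutativeRing)
open import Algebra.Bundles using (CommutativeRing)
open import Algebra.Properties.Group +-0-group using (inverseˡ-unique)
open import Algebra.Properties.Ring +-*-ring using (x[y-z]≈xy-xz)
open import Algebra.Properties.Semiring.Sum (CommutativeRing.semiring +-*-commutativeRing)
  using (sum; sum-cong-≗; ∑-distrib-+; ∑-comm; sum-remove; *-distribˡ-sum; *-distribʳ-sum)

open ≡-Reasoning

ℚ-ring : AlmostCommutativeRing 0ℓ 0ℓ
ℚ-ring = fromCommutativeRing +-*-commutativeRing 0≟
  where
  0≟ : ∀ x → Maybe (0ℚ ≡ x)
  0≟ x with 0ℚ ≟ x
  ... | yes 0≡x = just 0≡x
  ... | no  _   = nothing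

p≢0∧p*q≡0⇒q≡0 : ∀ {p q} → p ≢ 0ℚ → p *ℚ q ≡ 0ℚ → q ≡ 0ℚ
p≢0∧p*q≡0⇒q≡0 {p} {q} p≢0 pq≡0 = begin
  q                   ≡⟨ *-identityˡ q ⟨
  1ℚ *ℚ q             ≡⟨ cong (_*ℚ q) (*-inverseˡ p) ⟨
  (1/ p) *ℚ p *ℚ q    ≡⟨ *-assoc (1/ p) p q ⟩
  (1/ p) *ℚ (p *ℚ q)  ≡⟨ cong ((1/ p) *ℚ_) pq≡0 ⟩
  (1/ p) *ℚ 0ℚ        ≡⟨ *-zeroʳ (1/ p) ⟩
  0ℚ                  ∎
  where instance _ = ≢-nonZero p≢0

a-a*1≡0 : ∀ a → a -ℚ a *ℚ 1ℚ ≡ 0ℚ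
a-a*1≡0 = solve-∀ ℚ-ring

-s*v+l≡l-s*v : ∀ s v l → (- s) *ℚ v +ℚ l ≡ l -ℚ s *ℚ v
-s*v+l≡l-s*v = solve-∀ ℚ-ring

-- Finite sums

Σ≡sum : ∀ {n} (f : Fin n → ℚ) → Σ[ f ] ≡ sum f
Σ≡sum {zero}  f = refl
Σ≡sum {suc n} f = cong (f zero +ℚ_) (Σ≡sum (f ∘ suc))

Σ-cong : ∀ {n} {f g : Fin n → ℚ} → f ≗ g → Σ[ f ] ≡ Σ[ g ]
Σ-cong {f = f} {g} f≗g = trans (Σ≡sum f) (trans (sum-cong-≗ f≗g) (sym (Σ≡sum g)))

Σ-zero : ∀ {n} {f : Fin n → ℚ} → (∀ i → f i ≡ 0ℚ) → Σ[ f ] ≡ 0ℚ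
Σ-zero {zero}  f≡0 = refl
Σ-zero {suc n} f≡0 = cong₂ _+ℚ_ (f≡0 zero) (Σ-zero (f≡0 ∘ suc))

Σ-distrib-+ : ∀ {n} (f g : Fin n → ℚ) → Σ[ (λ i → f i +ℚ g i) ] ≡ Σ[ f ] +ℚ Σ[ g ]
Σ-distrib-+ f g = begin
  Σ[ (λ i → f i +ℚ g i) ]  ≡⟨ Σ≡sum (λ i → f i +ℚ g i) ⟩
  sum (λ i → f i +ℚ g i)   ≡⟨ ∑-distrib-+ f g ⟩
  sum f +ℚ sum g           ≡⟨ cong₂ _+ℚ_ (Σ≡sum f) (Σ≡sum g) ⟨
  Σ[ f ] +ℚ Σ[ g ]         ∎

*-distribˡ-Σ : ∀ {n} x (f : Fin n → ℚ) → x *ℚ Σ[ f ] ≡ Σ[ (λ i → x *ℚ f i) ]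
*-distribˡ-Σ x f = begin
  x *ℚ Σ[ f ]               ≡⟨ cong (x *ℚ_) (Σ≡sum f) ⟩
  x *ℚ sum f                ≡⟨ *-distribˡ-sum x f ⟩
  sum (λ i → x *ℚ f i)      ≡⟨ Σ≡sum (λ i → x *ℚ f i) ⟨
  Σ[ (λ i → x *ℚ f i) ]     ∎

*-distribʳ-Σ : ∀ {n} x (f : Fin n → ℚ) → Σ[ f ] *ℚ x ≡ Σ[ (λ i → f i *ℚ x) ]
*-distribʳ-Σ x f = begin
  Σ[ f ] *ℚ x               ≡⟨ cong (_*ℚ x) (Σ≡sum f) ⟩
  sum f *ℚ x                ≡⟨ *-distribʳ-sum x f ⟩
  sum (λ i → f i *ℚ x)      ≡⟨ Σ≡sum (λ i → f i *ℚ x) ⟨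
  Σ[ (λ i → f i *ℚ x) ]     ∎

Σ-comm : ∀ {m n} (f : Fin m → Fin n → ℚ) →
         Σ[ (λ i → Σ[ f i ]) ] ≡ Σ[ (λ j → Σ[ (λ i → f i j) ]) ]
Σ-comm f = begin
  Σ[ (λ i → Σ[ f i ]) ]               ≡⟨ Σ²≡sum² f ⟩
  sum (λ i → sum (f i))               ≡⟨ ∑-comm f ⟩
  sum (λ j → sum (λ i → f i j))       ≡⟨ Σ²≡sum² (λ j i → f i j) ⟨
  Σ[ (λ j → Σ[ (λ i → f i j) ]) ]     ∎
  where
  Σ²≡sum² : ∀ {m n} (g : Fin m → Fin n → ℚ) → Σ[ (λ i → Σ[ g i ]) ] ≡ sum (λ i → sum (g i))
  Σ²≡sum² g = trans (Σ≡sum (λ i → Σ[ g i ])) (sum-cong-≗ (Σ≡sum ∘ g))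

Σ-distrib-sub : ∀ {n} (f g : Fin n → ℚ) → Σ[ (λ i → f i -ℚ g i) ] ≡ Σ[ f ] -ℚ Σ[ g ]
Σ-distrib-sub f g = begin
  Σ[ (λ i → f i -ℚ g i) ]              ≡⟨ Σ-cong (λ i → neg-as-scaling (f i) (g i)) ⟩
  Σ[ (λ i → f i +ℚ (- 1ℚ) *ℚ g i) ]    ≡⟨ Σ-distrib-+ f (λ i → (- 1ℚ) *ℚ g i) ⟩
  Σ[ f ] +ℚ Σ[ (λ i → (- 1ℚ) *ℚ g i) ] ≡⟨ cong (Σ[ f ] +ℚ_) (*-distribˡ-Σ (- 1ℚ) g) ⟨
  Σ[ f ] +ℚ (- 1ℚ) *ℚ Σ[ g ]           ≡⟨ neg-as-scaling Σ[ f ] Σ[ g ] ⟨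
  Σ[ f ] -ℚ Σ[ g ]                     ∎
  where
  neg-as-scaling : ∀ a b → a -ℚ b ≡ a +ℚ (- 1ℚ) *ℚ b
  neg-as-scaling = solve-∀ ℚ-ring

Σ-remove : ∀ {n} (p : Fin (suc n)) (f : Fin (suc n) → ℚ) → Σ[ f ] ≡ f p +ℚ Σ[ f ∘ punchIn p ]
Σ-remove p f = begin
  Σ[ f ]                         ≡⟨ Σ≡sum f ⟩
  sum f                          ≡⟨ sum-remove f ⟩
  f p +ℚ sum (f ∘ punchIn p)     ≡⟨ cong (f p +ℚ_) (Σ≡sum (f ∘ punchIn p)) ⟨
  f p +ℚ Σ[ f ∘ punchIn p ]      ∎

Σ-++ : ∀ m {n} (f : Fin (m + n) → ℚ) → Σ[ f ] ≡ Σ[ (λ i → f (i ↑ˡ n)) ] +ℚ Σ[ (λ j → f (m ↑ʳ j)) ]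
Σ-++ zero    f = sym (+-identityˡ Σ[ f ])
Σ-++ (suc m) f = trans (cong (f zero +ℚ_) (Σ-++ m (f ∘ suc))) (sym (+-assoc (f zero) _ _))

-- Linear combinations and Gaussian elimination

0ᵥ : ∀ {n} → Fin n → ℚ
0ᵥ _ = 0ℚ

1ᵥ : ∀ {n} → Fin n → ℚ
1ᵥ _ = 1ℚ

zero-or-nonzero : ∀ {n} (f : Fin n → ℚ) → (∀ i → f i ≡ 0ℚ) ⊎ ∃ λ i → f i ≢ 0ℚ
zero-or-nonzero {n} f with all? (λ i → f i ≟ 0ℚ)
... | yes f≡0 = inj₁ f≡0
... | no  f≢0 = inj₂ (¬∀⟶∃¬ n (λ i → f i ≡ 0ℚ) (λ i → f i ≟ 0ℚ) f≢0)

punchIn-elim : ∀ {n} {P : Fin (suc n) → Set} (p : Fin (suc n)) →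
               P p → (∀ a → P (punchIn p a)) → ∀ i → P i
punchIn-elim {P = P} p Pp Pp+ i with p Fin.≟ i
... | yes refl = Pp
... | no  p≢i  = subst P (punchIn-punchOut p≢i) (Pp+ (punchOut p≢i))

lc : ∀ {k N} → (Fin k → ℚ) → (Fin k → Fin N → ℚ) → Fin N → ℚ
lc c vs x = Σ[ (λ i → c i *ℚ vs i x) ]

LinDep : ∀ {N k} → (Fin k → Fin N → ℚ) → Set
LinDep vs = Σ _ λ c → lc c vs ≗ 0ᵥ × ∃ λ i → c i ≢ 0ℚ

lc-zeroˡ : ∀ {k N} {c : Fin k → ℚ} (vs : Fin k → Fin N → ℚ) → c ≗ 0ᵥ → lc c vs ≗ 0ᵥ
lc-zeroˡ vs c≡0 x = Σ-zero (λ i → trans (cong (_*ℚ vs i x) (c≡0 i)) (*-zeroˡ (vs i x)))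

lc-zeroʳ : ∀ {k N} (c : Fin k → ℚ) {vs : Fin k → Fin N → ℚ} {x} → (∀ i → vs i x ≡ 0ℚ) → lc c vs x ≡ 0ℚ
lc-zeroʳ c vsₓ≡0 = Σ-zero (λ i → trans (cong (c i *ℚ_) (vsₓ≡0 i)) (*-zeroʳ (c i)))

lc-cong : ∀ {k N} {c d : Fin k → ℚ} (vs : Fin k → Fin N → ℚ) → c ≗ d → lc c vs ≗ lc d vs
lc-cong vs c≗d x = Σ-cong (λ i → cong (_*ℚ vs i x) (c≗d i))

lc-remove : ∀ {k N} (p : Fin (suc k)) (c : Fin (suc k) → ℚ) (vs : Fin (suc k) → Fin N → ℚ) x →
            lc c vs x ≡ c p *ℚ vs p x +ℚ lc (c ∘ punchIn p) (vs ∘ punchIn p) x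
lc-remove p c vs x = Σ-remove p (λ i → c i *ℚ vs i x)

lc-insertAt : ∀ {k N} (p : Fin (suc k)) (c : Fin k → ℚ) a (vs : Fin (suc k) → Fin N → ℚ) x →
              lc (insertAt c p a) vs x ≡ a *ℚ vs p x +ℚ lc c (vs ∘ punchIn p) x
lc-insertAt p c a vs x = trans (lc-remove p (insertAt c p a) vs x)
  (cong₂ _+ℚ_ (cong (_*ℚ vs p x) (insertAt-lookup c p a))
              (lc-cong (vs ∘ punchIn p) (insertAt-punchIn c p a) x))

lc-linear : ∀ {k N} (α β : Fin k → ℚ) t (vs : Fin k → Fin N → ℚ) x →
            lc (λ i → α i +ℚ t *ℚ β i) vs x ≡ lc α vs x +ℚ t *ℚ lc β vs x
lc-linear α β t vs x = begin
  Σ[ (λ i → (α i +ℚ t *ℚ β i) *ℚ vs i x) ]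
    ≡⟨ Σ-cong (λ i → distrib (α i) t (β i) (vs i x)) ⟩
  Σ[ (λ i → α i *ℚ vs i x +ℚ t *ℚ (β i *ℚ vs i x)) ]
    ≡⟨ Σ-distrib-+ (λ i → α i *ℚ vs i x) (λ i → t *ℚ (β i *ℚ vs i x)) ⟩
  lc α vs x +ℚ Σ[ (λ i → t *ℚ (β i *ℚ vs i x)) ]
    ≡⟨ cong (lc α vs x +ℚ_) (*-distribˡ-Σ t (λ i → β i *ℚ vs i x)) ⟨
  lc α vs x +ℚ t *ℚ lc β vs x ∎
  where
  distrib : ∀ a t b v → (a +ℚ t *ℚ b) *ℚ v ≡ a *ℚ v +ℚ t *ℚ (b *ℚ v)
  distrib = solve-∀ ℚ-ring

lc-sub-multiple : ∀ {k N} (c a : Fin k → ℚ) (vs : Fin k → Fin N → ℚ) (e : Fin N → ℚ) x →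
                  lc c (λ i y → vs i y -ℚ a i *ℚ e y) x ≡ lc c vs x -ℚ Σ[ (λ i → c i *ℚ a i) ] *ℚ e x
lc-sub-multiple c a vs e x = begin
  Σ[ (λ i → c i *ℚ (vs i x -ℚ a i *ℚ e x)) ]
    ≡⟨ Σ-cong (λ i → distrib (c i) (vs i x) (a i) (e x)) ⟩
  Σ[ (λ i → c i *ℚ vs i x +ℚ (- e x) *ℚ (c i *ℚ a i)) ]
    ≡⟨ Σ-distrib-+ (λ i → c i *ℚ vs i x) (λ i → (- e x) *ℚ (c i *ℚ a i)) ⟩
  lc c vs x +ℚ Σ[ (λ i → (- e x) *ℚ (c i *ℚ a i)) ]
    ≡⟨ cong (lc c vs x +ℚ_) (*-distribˡ-Σ (- e x) (λ i → c i *ℚ a i)) ⟨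
  lc c vs x +ℚ (- e x) *ℚ Σ[ (λ i → c i *ℚ a i) ]
    ≡⟨ regroup (lc c vs x) (e x) Σ[ (λ i → c i *ℚ a i) ] ⟩
  lc c vs x -ℚ Σ[ (λ i → c i *ℚ a i) ] *ℚ e x ∎
  where
  distrib : ∀ c v a e → c *ℚ (v -ℚ a *ℚ e) ≡ c *ℚ v +ℚ (- e) *ℚ (c *ℚ a)
  distrib = solve-∀ ℚ-ring
  regroup : ∀ l e s → l +ℚ (- e) *ℚ s ≡ l -ℚ s *ℚ e
  regroup = solve-∀ ℚ-ring

-- One step of elimination with pivot vs p zero ≢ 0: subtracting multiples of vs p clears the first
-- coordinate, and the relations among vs are exactly the lifts of relations among the reduced vectors.
module Elimination {N k} (vs : Fin (suc k) → Fin (suc N) → ℚ) (p : Fin (suc k)) (vₚ≢0 : vs p zero ≢ 0ℚ) where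

  private
    instance
      vₚ-nonZero : NonZero (vs p zero)
      vₚ-nonZero = ≢-nonZero vₚ≢0

  multiplier : Fin k → ℚ
  multiplier a = vs (punchIn p a) zero *ℚ (1/ vs p zero)

  reduced : Fin k → Fin N → ℚ
  reduced a y = vs (punchIn p a) (suc y) -ℚ multiplier a *ℚ vs p (suc y)

  weight : (Fin k → ℚ) → ℚ
  weight d = Σ[ (λ a → d a *ℚ multiplier a) ]

  lift : (Fin k → ℚ) → Fin (suc k) → ℚ
  lift d = insertAt d p (- weight d)

  weight-pivot : ∀ d → weight d *ℚ vs p zero ≡ lc d (vs ∘ punchIn p) zero
  weight-pivot d = begin
    weight d *ℚ vs p zero
      ≡⟨ *-distribʳ-Σ (vs p zero) (λ a → d a *ℚ multiplier a) ⟩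
    Σ[ (λ a → d a *ℚ multiplier a *ℚ vs p zero) ]
      ≡⟨ Σ-cong (λ a → regroup (d a) (vs (punchIn p a) zero) (1/ vs p zero) (vs p zero)) ⟩
    Σ[ (λ a → d a *ℚ vs (punchIn p a) zero *ℚ (1/ vs p zero *ℚ vs p zero)) ]
      ≡⟨ Σ-cong (λ a → trans (cong (d a *ℚ vs (punchIn p a) zero *ℚ_) (*-inverseˡ (vs p zero)))
                             (*-identityʳ (d a *ℚ vs (punchIn p a) zero))) ⟩
    lc d (vs ∘ punchIn p) zero ∎
    where
    regroup : ∀ d v r w → d *ℚ (v *ℚ r) *ℚ w ≡ d *ℚ v *ℚ (r *ℚ w)
    regroup = solve-∀ ℚ-ring

  lc-lift-zero : ∀ d → lc (lift d) vs zero ≡ 0ℚ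
  lc-lift-zero d = begin
    lc (lift d) vs zero                                      ≡⟨ lc-insertAt p d (- weight d) vs zero ⟩
    (- weight d) *ℚ vs p zero +ℚ lc d (vs ∘ punchIn p) zero  ≡⟨ cong ((- weight d) *ℚ vs p zero +ℚ_) (weight-pivot d) ⟨
    (- weight d) *ℚ vs p zero +ℚ weight d *ℚ vs p zero       ≡⟨ cancel (weight d) (vs p zero) ⟩
    0ℚ                                                       ∎
    where
    cancel : ∀ s v → (- s) *ℚ v +ℚ s *ℚ v ≡ 0ℚ
    cancel = solve-∀ ℚ-ring

  lc-lift-suc : ∀ d y → lc (lift d) vs (suc y) ≡ lc d reduced y
  lc-lift-suc d y = begin
    lc (lift d) vs (suc y)
      ≡⟨ lc-insertAt p d (- weight d) vs (suc y) ⟩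
    (- weight d) *ℚ vs p (suc y) +ℚ lc d (vs ∘ punchIn p) (suc y)
      ≡⟨ -s*v+l≡l-s*v (weight d) (vs p (suc y)) (lc d (vs ∘ punchIn p) (suc y)) ⟩
    lc d (vs ∘ punchIn p) (suc y) -ℚ weight d *ℚ vs p (suc y)
      ≡⟨ lc-sub-multiple d multiplier (λ a → vs (punchIn p a) ∘ suc) (vs p ∘ suc) y ⟨
    lc d reduced y ∎

  relation-is-lifted : ∀ c → lc c vs zero ≡ 0ℚ → c ≗ lift (c ∘ punchIn p)
  relation-is-lifted c rel i = trans (sym (insertAt-removeAt c p i))
    (cong (λ a → insertAt (c ∘ punchIn p) p a i) (inverseˡ-unique (c p) (weight (c ∘ punchIn p)) pivot-sum))
    where
    pivot-sum : c p +ℚ weight (c ∘ punchIn p) ≡ 0ℚ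
    pivot-sum = p≢0∧p*q≡0⇒q≡0 vₚ≢0 (begin
      vs p zero *ℚ (c p +ℚ weight (c ∘ punchIn p))
        ≡⟨ distrib (vs p zero) (c p) (weight (c ∘ punchIn p)) ⟩
      c p *ℚ vs p zero +ℚ weight (c ∘ punchIn p) *ℚ vs p zero
        ≡⟨ cong (c p *ℚ vs p zero +ℚ_) (weight-pivot (c ∘ punchIn p)) ⟩
      c p *ℚ vs p zero +ℚ lc (c ∘ punchIn p) (vs ∘ punchIn p) zero
        ≡⟨ lc-remove p c vs zero ⟨
      lc c vs zero ≡⟨ rel ⟩
      0ℚ ∎)
      where
      distrib : ∀ v c s → v *ℚ (c +ℚ s) ≡ c *ℚ v +ℚ s *ℚ v
      distrib = solve-∀ ℚ-ring

  dependent : LinDep reduced → LinDep vs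
  dependent (d , rel , a , dₐ≢0) = lift d , rel′ , punchIn p a , dₐ≢0 ∘ trans (sym (insertAt-punchIn d p _ a))
    where
    rel′ : lc (lift d) vs ≗ 0ᵥ
    rel′ zero    = lc-lift-zero d
    rel′ (suc y) = trans (lc-lift-suc d y) (rel y)

  independent : LinIndep reduced → LinIndep vs
  independent indep c rel = punchIn-elim p cₚ≡0 d≡0
    where
    d≡0 : c ∘ punchIn p ≗ 0ᵥ
    d≡0 = indep (c ∘ punchIn p) λ y → begin
      lc (c ∘ punchIn p) reduced y         ≡⟨ lc-lift-suc (c ∘ punchIn p) y ⟨
      lc (lift (c ∘ punchIn p)) vs (suc y) ≡⟨ lc-cong vs (relation-is-lifted c (rel zero)) (suc y) ⟨
      lc c vs (suc y)                      ≡⟨ rel (suc y) ⟩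
      0ℚ                                   ∎
    cₚ≡0 : c p ≡ 0ℚ
    cₚ≡0 = begin
      c p                                ≡⟨ relation-is-lifted c (rel zero) p ⟩
      lift (c ∘ punchIn p) p             ≡⟨ insertAt-lookup (c ∘ punchIn p) p _ ⟩
      - weight (c ∘ punchIn p)           ≡⟨ cong -_ (Σ-zero weight-terms≡0) ⟩
      0ℚ                                 ∎
      where
      weight-terms≡0 : ∀ a → c (punchIn p a) *ℚ multiplier a ≡ 0ℚ
      weight-terms≡0 a = trans (cong (_*ℚ multiplier a) (d≡0 a)) (*-zeroˡ (multiplier a))

LinIndepDecision : ∀ {N k} → (Fin k → Fin N → ℚ) → Set
LinIndepDecision {N} {k} vs = (LinIndep vs × k ≤ N) ⊎ LinDep vs

drop-zero-coordinate : ∀ {N k} {vs : Fin k → Fin (suc N) → ℚ} → (∀ i → vs i zero ≡ 0ℚ) →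
                       LinIndepDecision (λ i → vs i ∘ suc) → LinIndepDecision vs
drop-zero-coordinate _ (inj₁ (indep , k≤N)) = inj₁ ((λ c rel → indep c (rel ∘ suc)) , ℕ.m≤n⇒m≤1+n k≤N)
drop-zero-coordinate {vs = vs} vs₀≡0 (inj₂ (c , rel , i , cᵢ≢0)) = inj₂ (c , rel′ , i , cᵢ≢0)
  where
  rel′ : lc c vs ≗ 0ᵥ
  rel′ zero    = lc-zeroʳ c {vs} vs₀≡0
  rel′ (suc y) = rel y

eliminate-pivot : ∀ {N k} (vs : Fin (suc k) → Fin (suc N) → ℚ) (p : Fin (suc k)) (vₚ≢0 : vs p zero ≢ 0ℚ) →
                  LinIndepDecision (Elimination.reduced vs p vₚ≢0) → LinIndepDecision vs
eliminate-pivot vs p vₚ≢0 (inj₁ (indep , k≤N)) = inj₁ (Elimination.independent vs p vₚ≢0 indep , s≤s k≤N)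
eliminate-pivot vs p vₚ≢0 (inj₂ dep)            = inj₂ (Elimination.dependent vs p vₚ≢0 dep)

linIndep? : ∀ {N k} (vs : Fin k → Fin N → ℚ) → LinIndepDecision vs
linIndep? {N}     {zero}  vs = inj₁ ((λ _ _ ()) , z≤n)
linIndep? {zero}  {suc k} vs = inj₂ (1ᵥ , (λ ()) , zero , 1≢0)
linIndep? {suc N} {suc k} vs with zero-or-nonzero (λ i → vs i zero)
... | inj₁ vs₀≡0       = drop-zero-coordinate {vs = vs} vs₀≡0 (linIndep? (λ i → vs i ∘ suc))
... | inj₂ (p , vₚ≢0) = eliminate-pivot vs p vₚ≢0 (linIndep? (Elimination.reduced vs p vₚ≢0))

lc-scale : ∀ {k N} t (c : Fin k → ℚ) (vs : Fin k → Fin N → ℚ) x → t *ℚ lc c vs x ≡ lc (λ i → t *ℚ c i) vs x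
lc-scale t c vs x = trans (*-distribˡ-Σ t (λ i → c i *ℚ vs i x)) (Σ-cong (λ i → sym (*-assoc t (c i) (vs i x))))

lc-lc : ∀ {p q N} (d : Fin p → ℚ) (C : Fin p → Fin q → ℚ) (s : Fin q → Fin N → ℚ) x →
        lc d (λ i → lc (C i) s) x ≡ lc (lc d C) s x
lc-lc d C s x = begin
  Σ[ (λ i → d i *ℚ Σ[ (λ t → C i t *ℚ s t x) ]) ]
    ≡⟨ Σ-cong (λ i → *-distribˡ-Σ (d i) (λ t → C i t *ℚ s t x)) ⟩
  Σ[ (λ i → Σ[ (λ t → d i *ℚ (C i t *ℚ s t x)) ]) ]
    ≡⟨ Σ-comm (λ i t → d i *ℚ (C i t *ℚ s t x)) ⟩
  Σ[ (λ t → Σ[ (λ i → d i *ℚ (C i t *ℚ s t x)) ]) ]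
    ≡⟨ Σ-cong (λ t → Σ-cong (λ i → sym (*-assoc (d i) (C i t) (s t x)))) ⟩
  Σ[ (λ t → Σ[ (λ i → d i *ℚ C i t *ℚ s t x) ]) ]
    ≡⟨ Σ-cong (λ t → *-distribʳ-Σ (s t x) (λ i → d i *ℚ C i t)) ⟨
  Σ[ (λ t → lc d C t *ℚ s t x) ] ∎

-- Bases and dimension

module _ {N : ℕ} (P : (Fin N → ℚ) → Set) where

  Spans : ∀ {k} → (Fin k → Fin N → ℚ) → Set
  Spans vs = ∀ x → P x → ∃ λ α → x ≗ lc α vs

  record IsBasis {k} (vs : Fin k → Fin N → ℚ) : Set where
    field
      members     : ∀ i → P (vs i)
      independent : LinIndep vs
      spanning    : Spans vs

  Basis : ℕ → Set
  Basis k = Σ (Fin k → Fin N → ℚ) IsBasis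

  -- Nullity M k is Dim (InKernel M) k by definition.
  Dim : ℕ → Set
  Dim k = (Σ (Fin k → Fin N → ℚ) λ vs → (∀ i → P (vs i)) × LinIndep vs)
        × ((vs : Fin (suc k) → Fin N → ℚ) → (∀ i → P (vs i)) → ¬ LinIndep vs)

open IsBasis

solve-linear : ∀ {c x l} .{{_ : NonZero c}} → c *ℚ x +ℚ l ≡ 0ℚ → x ≡ (- (1/ c)) *ℚ l
solve-linear {c} {x} {l} cx+l≡0 = begin
  x                   ≡⟨ *-identityˡ x ⟨
  1ℚ *ℚ x             ≡⟨ cong (_*ℚ x) (*-inverseˡ c) ⟨
  (1/ c) *ℚ c *ℚ x    ≡⟨ *-assoc (1/ c) c x ⟩
  (1/ c) *ℚ (c *ℚ x)  ≡⟨ cong ((1/ c) *ℚ_) (inverseˡ-unique (c *ℚ x) l cx+l≡0) ⟩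
  (1/ c) *ℚ (- l)     ≡⟨ neg-swap (1/ c) l ⟩
  (- (1/ c)) *ℚ l     ∎
  where
  neg-swap : ∀ r l → r *ℚ (- l) ≡ (- r) *ℚ l
  neg-swap = solve-∀ ℚ-ring

∈span-of-dependent-extension : ∀ {N k} {vs : Fin k → Fin N → ℚ} {x} →
                               LinIndep vs → LinDep (x ∷ vs) → ∃ λ α → x ≗ lc α vs
∈span-of-dependent-extension {vs = vs} {x} indep (c , rel , j , cⱼ≢0) with c zero ≟ 0ℚ
... | yes c₀≡0 = ⊥-elim (cⱼ≢0 (c≡0 j))
  where
  c≡0 : c ≗ 0ᵥ
  c≡0 zero    = c₀≡0
  c≡0 (suc i) = indep (c ∘ suc) tail-relation i
    where
    tail-relation : lc (c ∘ suc) vs ≗ 0ᵥ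
    tail-relation y = begin
      lc (c ∘ suc) vs y                        ≡⟨ drop (x y) (lc (c ∘ suc) vs y) ⟨
      0ℚ *ℚ x y +ℚ lc (c ∘ suc) vs y           ≡⟨ cong (λ c₀ → c₀ *ℚ x y +ℚ lc (c ∘ suc) vs y) c₀≡0 ⟨
      c zero *ℚ x y +ℚ lc (c ∘ suc) vs y       ≡⟨ rel y ⟩
      0ℚ                                       ∎
      where
      drop : ∀ v l → 0ℚ *ℚ v +ℚ l ≡ l
      drop = solve-∀ ℚ-ring
... | no c₀≢0 = (λ i → (- (1/ c zero)) *ℚ c (suc i)) , λ y →
  trans (solve-linear {c zero} {x y} {lc (c ∘ suc) vs y} (rel y)) (lc-scale (- (1/ c zero)) (c ∘ suc) vs y)
  where instance _ = ≢-nonZero c₀≢0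

dim⇒basis : ∀ {N} {P : (Fin N → ℚ) → Set} {k} → Dim P k → Basis P k
dim⇒basis {P = P} ((vs , vs∈P , indep) , maximal) = vs , record
  { members = vs∈P ; independent = indep ; spanning = spans }
  where
  spans : Spans P vs
  spans x x∈P with linIndep? (x ∷ vs)
  ... | inj₁ (indep′ , _) = ⊥-elim (maximal (x ∷ vs) (λ { zero → x∈P ; (suc i) → vs∈P i }) indep′)
  ... | inj₂ dep          = ∈span-of-dependent-extension indep dep

independent-in-span⇒≤ : ∀ {N p q} {ws : Fin p → Fin N → ℚ} {s : Fin q → Fin N → ℚ} (C : Fin p → Fin q → ℚ) →
                        LinIndep ws → (∀ i → ws i ≗ lc (C i) s) → p ≤ q
independent-in-span⇒≤ {ws = ws} {s} C indep ws≗Cs with linIndep? C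
... | inj₁ (_ , p≤q)             = p≤q
... | inj₂ (d , rel , j , dⱼ≢0) = ⊥-elim (dⱼ≢0 (indep d rel′ j))
  where
  rel′ : lc d ws ≗ 0ᵥ
  rel′ x = begin
    lc d ws x                    ≡⟨ Σ-cong (λ i → cong (d i *ℚ_) (ws≗Cs i x)) ⟩
    lc d (λ i → lc (C i) s) x    ≡⟨ lc-lc d C s x ⟩
    lc (lc d C) s x              ≡⟨ lc-zeroˡ s rel x ⟩
    0ℚ                           ∎

basis⇒dim : ∀ {N} {P : (Fin N → ℚ) → Set} {k} → Basis P k → Dim P k
basis⇒dim {N} {P} {k} (vs , B) = (vs , members B , independent B) , too-many
  where
  too-many : (ws : Fin (suc k) → Fin N → ℚ) → (∀ i → P (ws i)) → ¬ LinIndep ws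
  too-many ws ws∈P indep = ℕ.<-irrefl refl
    (independent-in-span⇒≤ (λ i → proj₁ (spanning B (ws i) (ws∈P i))) indep (λ i → proj₂ (spanning B (ws i) (ws∈P i))))

exchange : ∀ {N k} {P : (Fin N → ℚ) → Set} {b : Fin (suc k) → Fin N → ℚ} {e β} (p : Fin (suc k)) →
           IsBasis P b → P e → e ≗ lc β b → β p ≢ 0ℚ → IsBasis P (e ∷ b ∘ punchIn p)
exchange {P = P} {b} {e} {β} p B e∈P e≗βb βₚ≢0 = record
  { members     = λ { zero → e∈P ; (suc a) → members B (punchIn p a) }
  ; independent = independent′
  ; spanning    = spanning′
  }
  where
  instance _ = ≢-nonZero βₚ≢0
  b′ = b ∘ punchIn p
  β′ = β ∘ punchIn p

  e-expansion : ∀ y → e y ≡ β p *ℚ b p y +ℚ lc β′ b′ y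
  e-expansion y = trans (e≗βb y) (lc-remove p β b y)

  independent′ : LinIndep (e ∷ b′)
  independent′ c rel = λ { zero → c₀≡0 ; (suc a) → c′≡0 a }
    where
    c′ = c ∘ suc
    γ : Fin (suc _) → ℚ
    γ = insertAt (λ a → c′ a +ℚ c zero *ℚ β′ a) p (c zero *ℚ β p)
    γ≡0 : γ ≗ 0ᵥ
    γ≡0 = independent B γ λ y → begin
      lc γ b y
        ≡⟨ lc-insertAt p _ (c zero *ℚ β p) b y ⟩
      c zero *ℚ β p *ℚ b p y +ℚ lc (λ a → c′ a +ℚ c zero *ℚ β′ a) b′ y
        ≡⟨ cong (c zero *ℚ β p *ℚ b p y +ℚ_) (lc-linear c′ β′ (c zero) b′ y) ⟩
      c zero *ℚ β p *ℚ b p y +ℚ (lc c′ b′ y +ℚ c zero *ℚ lc β′ b′ y)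
        ≡⟨ regroup (c zero) (β p) (b p y) (lc c′ b′ y) (lc β′ b′ y) ⟩
      c zero *ℚ (β p *ℚ b p y +ℚ lc β′ b′ y) +ℚ lc c′ b′ y
        ≡⟨ cong (λ z → c zero *ℚ z +ℚ lc c′ b′ y) (e-expansion y) ⟨
      c zero *ℚ e y +ℚ lc c′ b′ y
        ≡⟨ rel y ⟩
      0ℚ ∎
      where
      regroup : ∀ c β v l m → c *ℚ β *ℚ v +ℚ (l +ℚ c *ℚ m) ≡ c *ℚ (β *ℚ v +ℚ m) +ℚ l
      regroup = solve-∀ ℚ-ring
    c₀≡0 : c zero ≡ 0ℚ
    c₀≡0 = p≢0∧p*q≡0⇒q≡0 βₚ≢0 (trans (*-comm (β p) (c zero))
             (trans (sym (insertAt-lookup _ p (c zero *ℚ β p))) (γ≡0 p)))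
    c′≡0 : c′ ≗ 0ᵥ
    c′≡0 a = begin
      c′ a                          ≡⟨ +-identityʳ (c′ a) ⟨
      c′ a +ℚ 0ℚ                    ≡⟨ cong (c′ a +ℚ_) (trans (cong (_*ℚ β′ a) c₀≡0) (*-zeroˡ (β′ a))) ⟨
      c′ a +ℚ c zero *ℚ β′ a        ≡⟨ insertAt-punchIn _ p (c zero *ℚ β p) a ⟨
      γ (punchIn p a)               ≡⟨ γ≡0 (punchIn p a) ⟩
      0ℚ                            ∎

  spanning′ : Spans P (e ∷ b′)
  spanning′ x x∈P with spanning B x x∈P
  ... | α , x≗αb = (t ∷ λ a → α (punchIn p a) +ℚ (- t) *ℚ β′ a) , λ y → sym (begin
      t *ℚ e y +ℚ lc (λ a → α (punchIn p a) +ℚ (- t) *ℚ β′ a) b′ y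
        ≡⟨ cong₂ _+ℚ_ (cong (t *ℚ_) (e-expansion y)) (lc-linear (α ∘ punchIn p) β′ (- t) b′ y) ⟩
      t *ℚ (β p *ℚ b p y +ℚ lc β′ b′ y) +ℚ (lc (α ∘ punchIn p) b′ y +ℚ (- t) *ℚ lc β′ b′ y)
        ≡⟨ regroup t (β p) (b p y) (lc β′ b′ y) (lc (α ∘ punchIn p) b′ y) ⟩
      t *ℚ β p *ℚ b p y +ℚ lc (α ∘ punchIn p) b′ y
        ≡⟨ cong (λ z → z *ℚ b p y +ℚ lc (α ∘ punchIn p) b′ y) t*βₚ≡αₚ ⟩
      α p *ℚ b p y +ℚ lc (α ∘ punchIn p) b′ y
        ≡⟨ lc-remove p α b y ⟨
      lc α b y
        ≡⟨ x≗αb y ⟨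
      x y ∎)
    where
    t = α p *ℚ (1/ β p)
    t*βₚ≡αₚ : t *ℚ β p ≡ α p
    t*βₚ≡αₚ = trans (*-assoc (α p) (1/ β p) (β p)) (trans (cong (α p *ℚ_) (*-inverseˡ (β p))) (*-identityʳ (α p)))
    regroup : ∀ t β v m l → t *ℚ (β *ℚ v +ℚ m) +ℚ (l +ℚ (- t) *ℚ m) ≡ t *ℚ β *ℚ v +ℚ l
    regroup = solve-∀ ℚ-ring

basis-headed-by : ∀ {N k} {P : (Fin N → ℚ) → Set} {b : Fin k → Fin N → ℚ} {e} (u : Fin N) →
                  IsBasis P b → P e → e u ≢ 0ℚ →
                  Σ ℕ λ k′ → k ≡ suc k′ × Σ (Fin k′ → Fin N → ℚ) λ cs → IsBasis P (e ∷ cs)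
basis-headed-by {k = zero}  u B e∈P eᵤ≢0 = ⊥-elim (eᵤ≢0 (proj₂ (spanning B _ e∈P) u))
basis-headed-by {k = suc k} {b = b} u B e∈P eᵤ≢0 with spanning B _ e∈P
... | β , e≗βb with zero-or-nonzero β
...   | inj₁ β≡0         = ⊥-elim (eᵤ≢0 (trans (e≗βb u) (lc-zeroˡ b β≡0 u)))
...   | inj₂ (p , βₚ≢0) = k , refl , b ∘ punchIn p , exchange {β = β} p B e∈P e≗βb βₚ≢0

ker-sub-multiple : ∀ {N} (M : Fin N → Fin N → ℚ) {x e} → InKernel M x → InKernel M e →
                   ∀ c → InKernel M (λ y → x y -ℚ c *ℚ e y)
ker-sub-multiple M {x} {e} x∈ker e∈ker c r = begin
  Σ[ (λ j → M r j *ℚ (x j -ℚ c *ℚ e j)) ]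
    ≡⟨ Σ-cong (λ j → distrib (M r j) (x j) c (e j)) ⟩
  Σ[ (λ j → M r j *ℚ x j +ℚ (- c) *ℚ (M r j *ℚ e j)) ]
    ≡⟨ Σ-distrib-+ (λ j → M r j *ℚ x j) (λ j → (- c) *ℚ (M r j *ℚ e j)) ⟩
  (M · x) r +ℚ Σ[ (λ j → (- c) *ℚ (M r j *ℚ e j)) ]
    ≡⟨ cong ((M · x) r +ℚ_) (*-distribˡ-Σ (- c) (λ j → M r j *ℚ e j)) ⟨
  (M · x) r +ℚ (- c) *ℚ (M · e) r
    ≡⟨ cong₂ (λ z w → z +ℚ (- c) *ℚ w) (x∈ker r) (e∈ker r) ⟩
  0ℚ +ℚ (- c) *ℚ 0ℚ
    ≡⟨ trans (+-identityˡ _) (*-zeroʳ (- c)) ⟩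
  0ℚ ∎
  where
  distrib : ∀ m x c e → m *ℚ (x -ℚ c *ℚ e) ≡ m *ℚ x +ℚ (- c) *ℚ (m *ℚ e)
  distrib = solve-∀ ℚ-ring

·-cong : ∀ {N} (M : Fin N → Fin N → ℚ) {x y} → x ≗ y → M · x ≗ M · y
·-cong M x≗y r = Σ-cong (λ j → cong (M r j *ℚ_) (x≗y j))

0ᵥ-∈-ker : ∀ {N} (M : Fin N → Fin N → ℚ) → InKernel M 0ᵥ
0ᵥ-∈-ker M r = Σ-zero (λ j → *-zeroʳ (M r j))

hyperplane-section : ∀ {N k} {M : Fin N → Fin N → ℚ} {e : Fin N → ℚ} {cs : Fin k → Fin N → ℚ} (u : Fin N) →
                     e u ≡ 1ℚ → IsBasis (InKernel M) (e ∷ cs) →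
                     IsBasis (λ x → InKernel M x × x u ≡ 0ℚ) (λ i y → cs i y -ℚ cs i u *ℚ e y)
hyperplane-section {M = M} {e} {cs} u eᵤ≡1 B = record
  { members     = λ i → ker-sub-multiple M (members B (suc i)) (members B zero) (cs i u)
                      , trans (cong (λ z → cs i u -ℚ cs i u *ℚ z) eᵤ≡1) (a-a*1≡0 (cs i u))
  ; independent = independent′
  ; spanning    = spanning′
  }
  where
  independent′ : LinIndep (λ i y → cs i y -ℚ cs i u *ℚ e y)
  independent′ c rel = independent B ((- lc c cs u) ∷ c) relation ∘ suc
    where
    relation : lc ((- lc c cs u) ∷ c) (e ∷ cs) ≗ 0ᵥ
    relation y = begin
      (- lc c cs u) *ℚ e y +ℚ lc c cs y          ≡⟨ -s*v+l≡l-s*v (lc c cs u) (e y) (lc c cs y) ⟩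
      lc c cs y -ℚ lc c cs u *ℚ e y              ≡⟨ lc-sub-multiple c (λ i → cs i u) cs e y ⟨
      lc c (λ i y → cs i y -ℚ cs i u *ℚ e y) y   ≡⟨ rel y ⟩
      0ℚ                                         ∎
  spanning′ : Spans (λ x → InKernel M x × x u ≡ 0ℚ) (λ i y → cs i y -ℚ cs i u *ℚ e y)
  spanning′ x (x∈ker , xᵤ≡0) with spanning B x x∈ker
  ... | α , x≗αecs = α ∘ suc , λ y → begin
    x y
      ≡⟨ x≗αecs y ⟩
    α zero *ℚ e y +ℚ lc (α ∘ suc) cs y
      ≡⟨ cong (λ a → a *ℚ e y +ℚ lc (α ∘ suc) cs y) α₀≡ ⟩
    (- lc (α ∘ suc) cs u) *ℚ e y +ℚ lc (α ∘ suc) cs y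
      ≡⟨ -s*v+l≡l-s*v (lc (α ∘ suc) cs u) (e y) (lc (α ∘ suc) cs y) ⟩
    lc (α ∘ suc) cs y -ℚ lc (α ∘ suc) cs u *ℚ e y
      ≡⟨ lc-sub-multiple (α ∘ suc) (λ i → cs i u) cs e y ⟨
    lc (α ∘ suc) (λ i y → cs i y -ℚ cs i u *ℚ e y) y ∎
    where
    α₀≡ : α zero ≡ - lc (α ∘ suc) cs u
    α₀≡ = inverseˡ-unique (α zero) (lc (α ∘ suc) cs u) (begin
      α zero +ℚ lc (α ∘ suc) cs u          ≡⟨ cong (_+ℚ lc (α ∘ suc) cs u) (*-identityʳ (α zero)) ⟨
      α zero *ℚ 1ℚ +ℚ lc (α ∘ suc) cs u    ≡⟨ cong (λ z → α zero *ℚ z +ℚ lc (α ∘ suc) cs u) eᵤ≡1 ⟨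
      α zero *ℚ e u +ℚ lc (α ∘ suc) cs u   ≡⟨ x≗αecs u ⟨
      x u                                  ≡⟨ xᵤ≡0 ⟩
      0ℚ                                   ∎)

-- The net Laplacian

module _ {n} (Γ : SignedGraph (suc n)) where

  netLap-diag : ∀ i → netLap Γ i i ≡ netDeg Γ i -ℚ A Γ i i
  netLap-diag i with i Fin.≟ i
  ... | yes _   = refl
  ... | no  i≢i = ⊥-elim (i≢i refl)

  netLap-offdiag : ∀ {i j} → i ≢ j → netLap Γ i j ≡ 0ℚ -ℚ A Γ i j
  netLap-offdiag {i} {j} i≢j with i Fin.≟ j
  ... | yes i≡j = ⊥-elim (i≢j i≡j)
  ... | no  _   = refl

  netLap-apply : ∀ x i → (netLap Γ · x) i ≡ Σ[ (λ j → A Γ i j *ℚ (x i -ℚ x j)) ]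
  netLap-apply x i = begin
    Σ[ (λ j → netLap Γ i j *ℚ x j) ]
      ≡⟨ Σ-remove i (λ j → netLap Γ i j *ℚ x j) ⟩
    netLap Γ i i *ℚ x i +ℚ Σ[ (λ a → netLap Γ i (pᵢ a) *ℚ x (pᵢ a)) ]
      ≡⟨ cong₂ _+ℚ_ (cong (_*ℚ x i) (trans (netLap-diag i) (cong (_-ℚ A Γ i i) (Σ-remove i (A Γ i)))))
                    (Σ-cong (λ a → cong (_*ℚ x (pᵢ a)) (netLap-offdiag (punchInᵢ≢i i a ∘ sym)))) ⟩
    ((A Γ i i +ℚ S) -ℚ A Γ i i) *ℚ x i +ℚ Σ[ off ]
      ≡⟨ cong (_+ℚ Σ[ off ]) (cancel (A Γ i i) S (x i)) ⟩
    S *ℚ x i +ℚ Σ[ off ]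
      ≡⟨ cong (_+ℚ Σ[ off ]) (*-distribʳ-Σ (x i) (A Γ i ∘ pᵢ)) ⟩
    Σ[ (λ a → A Γ i (pᵢ a) *ℚ x i) ] +ℚ Σ[ off ]
      ≡⟨ Σ-distrib-+ (λ a → A Γ i (pᵢ a) *ℚ x i) off ⟨
    Σ[ (λ a → A Γ i (pᵢ a) *ℚ x i +ℚ off a) ]
      ≡⟨ Σ-cong (λ a → factor (A Γ i (pᵢ a)) (x i) (x (pᵢ a))) ⟩
    Σ[ (λ a → A Γ i (pᵢ a) *ℚ (x i -ℚ x (pᵢ a))) ]
      ≡⟨ pad (A Γ i i) (x i) _ ⟩
    A Γ i i *ℚ (x i -ℚ x i) +ℚ Σ[ (λ a → A Γ i (pᵢ a) *ℚ (x i -ℚ x (pᵢ a))) ]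
      ≡⟨ Σ-remove i (λ j → A Γ i j *ℚ (x i -ℚ x j)) ⟨
    Σ[ (λ j → A Γ i j *ℚ (x i -ℚ x j)) ] ∎
    where
    pᵢ = punchIn i
    S = Σ[ A Γ i ∘ pᵢ ]
    off : Fin n → ℚ
    off a = (0ℚ -ℚ A Γ i (pᵢ a)) *ℚ x (pᵢ a)
    cancel : ∀ d s x → ((d +ℚ s) -ℚ d) *ℚ x ≡ s *ℚ x
    cancel = solve-∀ ℚ-ring
    factor : ∀ a x y → a *ℚ x +ℚ (0ℚ -ℚ a) *ℚ y ≡ a *ℚ (x -ℚ y)
    factor = solve-∀ ℚ-ring
    pad : ∀ d x s → s ≡ d *ℚ (x -ℚ x) +ℚ s
    pad = solve-∀ ℚ-ring

  netLap-apply-around : ∀ x w i → (netLap Γ · x) i ≡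
                        A Γ i w *ℚ (x i -ℚ x w) +ℚ Σ[ (λ a → A Γ i (punchIn w a) *ℚ (x i -ℚ x (punchIn w a))) ]
  netLap-apply-around x w i = trans (netLap-apply x i) (Σ-remove w (λ j → A Γ i j *ℚ (x i -ℚ x j)))

  netLap-ones : InKernel (netLap Γ) 1ᵥ
  netLap-ones i = trans (netLap-apply 1ᵥ i) (Σ-zero (λ j → *-zeroʳ (A Γ i j)))

  Section : Fin (suc n) → (Fin (suc n) → ℚ) → Set
  Section w x = InKernel (netLap Γ) x × x w ≡ 0ℚ

  shift-into-section : ∀ {y} w → InKernel (netLap Γ) y → Section w (λ z → y z -ℚ y w *ℚ 1ℚ)
  shift-into-section {y} w y∈ker = ker-sub-multiple (netLap Γ) {y} {1ᵥ} y∈ker netLap-ones (y w) , a-a*1≡0 (y w)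

  netLap-column-sums : ∀ x → Σ[ netLap Γ · x ] ≡ 0ℚ
  netLap-column-sums x = begin
    Σ[ netLap Γ · x ]                                    ≡⟨ Σ-cong (netLap-apply x) ⟩
    Σ[ (λ i → Σ[ (λ j → A Γ i j *ℚ (x i -ℚ x j)) ]) ]    ≡⟨ Σ-cong split-row ⟩
    Σ[ (λ i → outer i -ℚ inner i) ]                      ≡⟨ Σ-distrib-sub outer inner ⟩
    Σ[ outer ] -ℚ Σ[ inner ]                             ≡⟨ cong (Σ[ outer ] -ℚ_) inner≡outer ⟩
    Σ[ outer ] -ℚ Σ[ outer ]                             ≡⟨ +-inverseʳ Σ[ outer ] ⟩
    0ℚ                                                   ∎
    where
    outer inner : Fin (suc n) → ℚ
    outer i = Σ[ (λ j → A Γ i j *ℚ x i) ]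
    inner i = Σ[ (λ j → A Γ i j *ℚ x j) ]
    split-row : ∀ i → Σ[ (λ j → A Γ i j *ℚ (x i -ℚ x j)) ] ≡ outer i -ℚ inner i
    split-row i = trans (Σ-cong (λ j → x[y-z]≈xy-xz (A Γ i j) (x i) (x j)))
                        (Σ-distrib-sub (λ j → A Γ i j *ℚ x i) (λ j → A Γ i j *ℚ x j))
    inner≡outer : Σ[ inner ] ≡ Σ[ outer ]
    inner≡outer = trans (Σ-comm (λ i j → A Γ i j *ℚ x j))
                        (Σ-cong (λ j → Σ-cong (λ i → cong (λ e → edgeVal e *ℚ x j) (symm Γ i j))))

  ker-from-all-but-one : ∀ {x} w → (∀ a → (netLap Γ · x) (punchIn w a) ≡ 0ℚ) → InKernel (netLap Γ) x
  ker-from-all-but-one {x} w vanish = punchIn-elim w at-w vanish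
    where
    at-w : (netLap Γ · x) w ≡ 0ℚ
    at-w = begin
      (netLap Γ · x) w                                          ≡⟨ +-identityʳ _ ⟨
      (netLap Γ · x) w +ℚ 0ℚ                                    ≡⟨ cong ((netLap Γ · x) w +ℚ_) (Σ-zero vanish) ⟨
      (netLap Γ · x) w +ℚ Σ[ (netLap Γ · x) ∘ punchIn w ]       ≡⟨ Σ-remove w (netLap Γ · x) ⟨
      Σ[ netLap Γ · x ]                                         ≡⟨ netLap-column-sums x ⟩
      0ℚ                                                        ∎

-- Coalescence

module _ {m n : ℕ} where

  left : Fin m → Fin (suc (m + n))
  left a = suc (a ↑ˡ n)

  right : Fin n → Fin (suc (m + n))
  right b = suc (m ↑ʳ b)

  classify-left : ∀ a → classify {m} {n} (left a) ≡ lv a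
  classify-left a rewrite splitAt-↑ˡ m a n = refl

  classify-right : ∀ b → classify {m} {n} (right b) ≡ rv b
  classify-right b rewrite splitAt-↑ʳ m n b = refl

  suc-++-elim : ∀ {P : Fin (suc (m + n)) → Set} →
                P zero → (∀ a → P (left a)) → (∀ b → P (right b)) → ∀ i → P i
  suc-++-elim P₀ Pₗ Pᵣ zero = P₀
  suc-++-elim {P} P₀ Pₗ Pᵣ (suc i) with splitAt m i in eq
  ... | inj₁ a = subst (P ∘ suc) (splitAt⁻¹-↑ˡ eq) (Pₗ a)
  ... | inj₂ b = subst (P ∘ suc) (splitAt⁻¹-↑ʳ eq) (Pᵣ b)

  Σ-suc-++ : (f : Fin (suc (m + n)) → ℚ) → Σ[ f ] ≡ f zero +ℚ (Σ[ f ∘ left ] +ℚ Σ[ f ∘ right ])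
  Σ-suc-++ f = cong (f zero +ℚ_) (Σ-++ m (f ∘ suc))

  Σ-classify : (h : CVertex m n → ℚ) → Σ[ h ∘ classify ] ≡ h wv +ℚ (Σ[ h ∘ lv ] +ℚ Σ[ h ∘ rv ])
  Σ-classify h = trans (Σ-suc-++ (h ∘ classify))
    (cong (h wv +ℚ_) (cong₂ _+ℚ_ (Σ-cong (cong h ∘ classify-left)) (Σ-cong (cong h ∘ classify-right))))

  lc-suc-++ : ∀ {N} (c : Fin (suc (m + n)) → ℚ) e (f : Fin m → Fin N → ℚ) (g : Fin n → Fin N → ℚ) y →
              lc c (e ∷ (f ++ g)) y ≡ c zero *ℚ e y +ℚ (lc (c ∘ left) f y +ℚ lc (c ∘ right) g y)
  lc-suc-++ c e f g y = trans (Σ-suc-++ (λ i → c i *ℚ (e ∷ (f ++ g)) i y))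
    (cong (c zero *ℚ e y +ℚ_) (cong₂ _+ℚ_
      (Σ-cong (λ a → cong (λ w → c (left a) *ℚ w y) (lookup-++ˡ f g a)))
      (Σ-cong (λ b → cong (λ w → c (right b) *ℚ w y) (lookup-++ʳ f g b)))))

module Coalescence {m n : ℕ} (Γ₁ : SignedGraph (suc m)) (u : Fin (suc m))
                   (Γ₂ : SignedGraph (suc n)) (v : Fin (suc n)) where

  Γ : SignedGraph (suc (m + n))
  Γ = coalescence Γ₁ u Γ₂ v

  -- The identified vertex takes the value y₁ u, so glue y₁ y₂ only restricts back to y₂ when y₁ u ≡ y₂ v.
  glueAt : (Fin (suc m) → ℚ) → (Fin (suc n) → ℚ) → CVertex m n → ℚ
  glueAt y₁ y₂ wv     = y₁ u
  glueAt y₁ y₂ (lv a) = y₁ (punchIn u a)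
  glueAt y₁ y₂ (rv b) = y₂ (punchIn v b)

  glue : (Fin (suc m) → ℚ) → (Fin (suc n) → ℚ) → Fin (suc (m + n)) → ℚ
  glue y₁ y₂ = glueAt y₁ y₂ ∘ classify

  restrict₁ : (Fin (suc (m + n)) → ℚ) → Fin (suc m) → ℚ
  restrict₁ x = insertAt (x ∘ left) u (x zero)

  restrict₂ : (Fin (suc (m + n)) → ℚ) → Fin (suc n) → ℚ
  restrict₂ x = insertAt (x ∘ right) v (x zero)

  restrict-agree : ∀ x → restrict₁ x u ≡ restrict₂ x v
  restrict-agree x = trans (insertAt-lookup (x ∘ left) u (x zero)) (sym (insertAt-lookup (x ∘ right) v (x zero)))

  glue-restrict : ∀ x → glue (restrict₁ x) (restrict₂ x) ≗ x
  glue-restrict x = suc-++-elim (insertAt-lookup (x ∘ left) u (x zero))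
    (λ a → trans (cong (glueAt (restrict₁ x) (restrict₂ x)) (classify-left a)) (insertAt-punchIn (x ∘ left) u (x zero) a))
    (λ b → trans (cong (glueAt (restrict₁ x) (restrict₂ x)) (classify-right b)) (insertAt-punchIn (x ∘ right) v (x zero) b))

  glue-cong : ∀ {y₁ y₁′ y₂ y₂′} → y₁ ≗ y₁′ → y₂ ≗ y₂′ → glue y₁ y₂ ≗ glue y₁′ y₂′
  glue-cong {y₁} {y₁′} {y₂} {y₂′} y₁≗ y₂≗ i = at (classify i)
    where
    at : ∀ X → glueAt y₁ y₂ X ≡ glueAt y₁′ y₂′ X
    at wv     = y₁≗ u
    at (lv a) = y₁≗ (punchIn u a)
    at (rv b) = y₂≗ (punchIn v b)

  lc-glue : ∀ {k} (c : Fin k → ℚ) f g → lc c (λ z → glue (f z) (g z)) ≗ glue (lc c f) (lc c g)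
  lc-glue c f g i = at (classify i)
    where
    at : ∀ X → Σ[ (λ z → c z *ℚ glueAt (f z) (g z) X) ] ≡ glueAt (lc c f) (lc c g) X
    at wv     = refl
    at (lv a) = refl
    at (rv b) = refl

  glue≗0 : ∀ {y₁ y₂} → glue y₁ y₂ ≗ 0ᵥ → y₁ ≗ 0ᵥ × (∀ b → y₂ (punchIn v b) ≡ 0ℚ)
  glue≗0 {y₁} {y₂} glue≡0 =
      punchIn-elim u (glue≡0 zero) (λ a → trans (cong (glueAt y₁ y₂) (sym (classify-left a))) (glue≡0 (left a)))
    , λ b → trans (cong (glueAt y₁ y₂) (sym (classify-right b))) (glue≡0 (right b))

  edge-term : (Fin (suc m) → ℚ) → (Fin (suc n) → ℚ) → CVertex m n → CVertex m n → ℚ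
  edge-term y₁ y₂ X Y = edgeVal (coalAdjC Γ₁ u Γ₂ v X Y) *ℚ (glueAt y₁ y₂ X -ℚ glueAt y₁ y₂ Y)

  vertexLap : (Fin (suc m) → ℚ) → (Fin (suc n) → ℚ) → CVertex m n → ℚ
  vertexLap y₁ y₂ X = edge-term y₁ y₂ X wv +ℚ (Σ[ edge-term y₁ y₂ X ∘ lv ] +ℚ Σ[ edge-term y₁ y₂ X ∘ rv ])

  netLap-glue : ∀ y₁ y₂ i → (netLap Γ · glue y₁ y₂) i ≡ vertexLap y₁ y₂ (classify i)
  netLap-glue y₁ y₂ i = trans (netLap-apply Γ (glue y₁ y₂) i) (Σ-classify (edge-term y₁ y₂ (classify i)))

  vertexLap-lv : ∀ y₁ y₂ a → vertexLap y₁ y₂ (lv a) ≡ (netLap Γ₁ · y₁) (punchIn u a)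
  vertexLap-lv y₁ y₂ a = begin
    to-u +ℚ (S +ℚ Σ[ edge-term y₁ y₂ (lv a) ∘ rv ])
      ≡⟨ cong (λ z → to-u +ℚ (S +ℚ z)) (Σ-zero (λ b → *-zeroˡ (y₁ (punchIn u a) -ℚ y₂ (punchIn v b)))) ⟩
    to-u +ℚ (S +ℚ 0ℚ)
      ≡⟨ cong (to-u +ℚ_) (+-identityʳ S) ⟩
    to-u +ℚ S
      ≡⟨ netLap-apply-around Γ₁ y₁ u (punchIn u a) ⟨
    (netLap Γ₁ · y₁) (punchIn u a) ∎
    where
    to-u = A Γ₁ (punchIn u a) u *ℚ (y₁ (punchIn u a) -ℚ y₁ u)
    S = Σ[ edge-term y₁ y₂ (lv a) ∘ lv ]

  vertexLap-rv : ∀ y₁ y₂ → y₁ u ≡ y₂ v → ∀ b → vertexLap y₁ y₂ (rv b) ≡ (netLap Γ₂ · y₂) (punchIn v b)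
  vertexLap-rv y₁ y₂ y₁ᵤ≡y₂ᵥ b = begin
    A Γ₂ (punchIn v b) v *ℚ (y₂ (punchIn v b) -ℚ y₁ u) +ℚ (Σ[ edge-term y₁ y₂ (rv b) ∘ lv ] +ℚ S)
      ≡⟨ cong₂ (λ z w → A Γ₂ (punchIn v b) v *ℚ (y₂ (punchIn v b) -ℚ z) +ℚ (w +ℚ S)) y₁ᵤ≡y₂ᵥ
               (Σ-zero (λ a → *-zeroˡ (y₂ (punchIn v b) -ℚ y₁ (punchIn u a)))) ⟩
    to-v +ℚ (0ℚ +ℚ S)
      ≡⟨ cong (to-v +ℚ_) (+-identityˡ S) ⟩
    to-v +ℚ S
      ≡⟨ netLap-apply-around Γ₂ y₂ v (punchIn v b) ⟨
    (netLap Γ₂ · y₂) (punchIn v b) ∎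
    where
    to-v = A Γ₂ (punchIn v b) v *ℚ (y₂ (punchIn v b) -ℚ y₂ v)
    S = Σ[ edge-term y₁ y₂ (rv b) ∘ rv ]

  vertexLap-wv : ∀ y₁ y₂ → y₁ u ≡ y₂ v → vertexLap y₁ y₂ wv ≡ (netLap Γ₁ · y₁) u +ℚ (netLap Γ₂ · y₂) v
  vertexLap-wv y₁ y₂ y₁ᵤ≡y₂ᵥ = begin
    0ℚ *ℚ (y₁ u -ℚ y₁ u) +ℚ (S₁ +ℚ Σ[ (λ b → A Γ₂ v (punchIn v b) *ℚ (y₁ u -ℚ y₂ (punchIn v b))) ])
      ≡⟨ cong (λ z → 0ℚ *ℚ (y₁ u -ℚ y₁ u) +ℚ (S₁ +ℚ z))
              (Σ-cong (λ b → cong (λ w → A Γ₂ v (punchIn v b) *ℚ (w -ℚ y₂ (punchIn v b))) y₁ᵤ≡y₂ᵥ)) ⟩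
    0ℚ *ℚ (y₁ u -ℚ y₁ u) +ℚ (S₁ +ℚ S₂)
      ≡⟨ regroup (y₁ u -ℚ y₁ u) (A Γ₁ u u) (y₁ u) (A Γ₂ v v) (y₂ v) S₁ S₂ ⟩
    (A Γ₁ u u *ℚ (y₁ u -ℚ y₁ u) +ℚ S₁) +ℚ (A Γ₂ v v *ℚ (y₂ v -ℚ y₂ v) +ℚ S₂)
      ≡⟨ cong₂ _+ℚ_ (netLap-apply-around Γ₁ y₁ u u) (netLap-apply-around Γ₂ y₂ v v) ⟨
    (netLap Γ₁ · y₁) u +ℚ (netLap Γ₂ · y₂) v ∎
    where
    S₁ = Σ[ (λ a → A Γ₁ u (punchIn u a) *ℚ (y₁ u -ℚ y₁ (punchIn u a))) ]
    S₂ = Σ[ (λ b → A Γ₂ v (punchIn v b) *ℚ (y₂ v -ℚ y₂ (punchIn v b))) ]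
    regroup : ∀ d a x b y s₁ s₂ →
              0ℚ *ℚ d +ℚ (s₁ +ℚ s₂) ≡ (a *ℚ (x -ℚ x) +ℚ s₁) +ℚ (b *ℚ (y -ℚ y) +ℚ s₂)
    regroup = solve-∀ ℚ-ring

  glue-∈-ker : ∀ {y₁ y₂} → InKernel (netLap Γ₁) y₁ → InKernel (netLap Γ₂) y₂ → y₁ u ≡ y₂ v →
               InKernel (netLap Γ) (glue y₁ y₂)
  glue-∈-ker {y₁} {y₂} y₁∈ker y₂∈ker y₁ᵤ≡y₂ᵥ i = trans (netLap-glue y₁ y₂ i) (at (classify i))
    where
    at : ∀ X → vertexLap y₁ y₂ X ≡ 0ℚ
    at wv     = trans (vertexLap-wv y₁ y₂ y₁ᵤ≡y₂ᵥ) (cong₂ _+ℚ_ (y₁∈ker u) (y₂∈ker v))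
    at (lv a) = trans (vertexLap-lv y₁ y₂ a) (y₁∈ker (punchIn u a))
    at (rv b) = trans (vertexLap-rv y₁ y₂ y₁ᵤ≡y₂ᵥ b) (y₂∈ker (punchIn v b))

  restrict-∈-ker : ∀ {x} → InKernel (netLap Γ) x →
                   InKernel (netLap Γ₁) (restrict₁ x) × InKernel (netLap Γ₂) (restrict₂ x)
  restrict-∈-ker {x} x∈ker =
      ker-from-all-but-one Γ₁ {y₁} u (λ a → trans (sym (vertexLap-lv y₁ y₂ a))
                                                  (at-vertex (left {n = n} a) (classify-left a)))
    , ker-from-all-but-one Γ₂ {y₂} v (λ b → trans (sym (vertexLap-rv y₁ y₂ (restrict-agree x) b))
                                                  (at-vertex (right {m} b) (classify-right b)))
    where
    y₁ = restrict₁ x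
    y₂ = restrict₂ x
    at-vertex : ∀ (i : Fin (suc (m + n))) {X} → classify i ≡ X → vertexLap y₁ y₂ X ≡ 0ℚ
    at-vertex i refl = begin
      vertexLap y₁ y₂ (classify i)     ≡⟨ netLap-glue y₁ y₂ i ⟨
      (netLap Γ · glue y₁ y₂) i        ≡⟨ ·-cong (netLap Γ) (glue-restrict x) i ⟩
      (netLap Γ · x) i                 ≡⟨ x∈ker i ⟩
      0ℚ                               ∎

  module GluedBasis {k₁ k₂} {b₁ : Fin k₁ → Fin (suc m) → ℚ} {b₂ : Fin k₂ → Fin (suc n) → ℚ}
                    (B₁ : IsBasis (Section Γ₁ u) b₁) (B₂ : IsBasis (Section Γ₂ v) b₂) where

    side₁ : Fin (suc (k₁ + k₂)) → Fin (suc m) → ℚ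
    side₁ = 1ᵥ ∷ (b₁ ++ λ _ → 0ᵥ)

    side₂ : Fin (suc (k₁ + k₂)) → Fin (suc n) → ℚ
    side₂ = 1ᵥ ∷ ((λ _ → 0ᵥ) ++ b₂)

    basis : Fin (suc (k₁ + k₂)) → Fin (suc (m + n)) → ℚ
    basis z = glue (side₁ z) (side₂ z)

    coeffs₁ : (Fin (suc (k₁ + k₂)) → ℚ) → Fin k₁ → ℚ
    coeffs₁ c = c ∘ left

    coeffs₂ : (Fin (suc (k₁ + k₂)) → ℚ) → Fin k₂ → ℚ
    coeffs₂ c = c ∘ right

    lc-side₁ : ∀ c y → lc c side₁ y ≡ c zero +ℚ lc (coeffs₁ c) b₁ y
    lc-side₁ c y = begin
      lc c side₁ y
        ≡⟨ lc-suc-++ c 1ᵥ b₁ (λ _ → 0ᵥ) y ⟩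
      c zero *ℚ 1ℚ +ℚ (lc (coeffs₁ c) b₁ y +ℚ lc (coeffs₂ c) (λ _ → 0ᵥ) y)
        ≡⟨ cong (λ z → c zero *ℚ 1ℚ +ℚ (lc (coeffs₁ c) b₁ y +ℚ z)) no-contribution ⟩
      c zero *ℚ 1ℚ +ℚ (lc (coeffs₁ c) b₁ y +ℚ 0ℚ)
        ≡⟨ tidy (c zero) (lc (coeffs₁ c) b₁ y) ⟩
      c zero +ℚ lc (coeffs₁ c) b₁ y ∎
      where
      no-contribution : lc (coeffs₂ c) (λ _ → 0ᵥ) y ≡ 0ℚ
      no-contribution = lc-zeroʳ (coeffs₂ c) {λ _ → 0ᵥ} {y} (λ _ → refl)
      tidy : ∀ c l → c *ℚ 1ℚ +ℚ (l +ℚ 0ℚ) ≡ c +ℚ l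
      tidy = solve-∀ ℚ-ring

    lc-side₂ : ∀ c y → lc c side₂ y ≡ c zero +ℚ lc (coeffs₂ c) b₂ y
    lc-side₂ c y = begin
      lc c side₂ y
        ≡⟨ lc-suc-++ c 1ᵥ (λ _ → 0ᵥ) b₂ y ⟩
      c zero *ℚ 1ℚ +ℚ (lc (coeffs₁ c) (λ _ → 0ᵥ) y +ℚ lc (coeffs₂ c) b₂ y)
        ≡⟨ cong (λ z → c zero *ℚ 1ℚ +ℚ (z +ℚ lc (coeffs₂ c) b₂ y)) no-contribution ⟩
      c zero *ℚ 1ℚ +ℚ (0ℚ +ℚ lc (coeffs₂ c) b₂ y)
        ≡⟨ tidy (c zero) (lc (coeffs₂ c) b₂ y) ⟩
      c zero +ℚ lc (coeffs₂ c) b₂ y ∎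
      where
      no-contribution : lc (coeffs₁ c) (λ _ → 0ᵥ) y ≡ 0ℚ
      no-contribution = lc-zeroʳ (coeffs₁ c) {λ _ → 0ᵥ} {y} (λ _ → refl)
      tidy : ∀ c l → c *ℚ 1ℚ +ℚ (0ℚ +ℚ l) ≡ c +ℚ l
      tidy = solve-∀ ℚ-ring

    basis-left : ∀ a → basis (left a) ≡ glue (b₁ a) 0ᵥ
    basis-left a = cong₂ glue (lookup-++ˡ b₁ (λ _ → 0ᵥ) a) (lookup-++ˡ (λ _ → 0ᵥ) b₂ a)

    basis-right : ∀ b → basis (right b) ≡ glue 0ᵥ (b₂ b)
    basis-right b = cong₂ glue (lookup-++ʳ b₁ (λ _ → 0ᵥ) b) (lookup-++ʳ {m = k₁} (λ _ → 0ᵥ) b₂ b)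

    members′ : ∀ z → InKernel (netLap Γ) (basis z)
    members′ = suc-++-elim
      (glue-∈-ker (netLap-ones Γ₁) (netLap-ones Γ₂) refl)
      (λ a → subst (InKernel (netLap Γ)) (sym (basis-left a))
               (glue-∈-ker (proj₁ (members B₁ a)) (0ᵥ-∈-ker (netLap Γ₂)) (proj₂ (members B₁ a))))
      (λ b → subst (InKernel (netLap Γ)) (sym (basis-right b))
               (glue-∈-ker (0ᵥ-∈-ker (netLap Γ₁)) (proj₁ (members B₂ b)) (sym (proj₂ (members B₂ b)))))

    independent′ : LinIndep basis
    independent′ c rel =
      suc-++-elim c₀≡0 (independent B₁ (coeffs₁ c) side₁-rel) (independent B₂ (coeffs₂ c) side₂-rel)
      where
      sides≡0 = glue≗0 (λ y → trans (sym (lc-glue c side₁ side₂ y)) (rel y))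
      side₁≡0 : ∀ y → c zero +ℚ lc (coeffs₁ c) b₁ y ≡ 0ℚ
      side₁≡0 y = trans (sym (lc-side₁ c y)) (proj₁ sides≡0 y)
      c₀≡0 : c zero ≡ 0ℚ
      c₀≡0 = begin
        c zero                         ≡⟨ +-identityʳ (c zero) ⟨
        c zero +ℚ 0ℚ                   ≡⟨ cong (c zero +ℚ_) (lc-zeroʳ (coeffs₁ c) {b₁} {u} (proj₂ ∘ members B₁)) ⟨
        c zero +ℚ lc (coeffs₁ c) b₁ u  ≡⟨ side₁≡0 u ⟩
        0ℚ                             ∎
      drop-c₀ : ∀ {l} → c zero +ℚ l ≡ 0ℚ → l ≡ 0ℚ
      drop-c₀ {l} c₀+l≡0 = trans (sym (+-identityˡ l)) (trans (cong (_+ℚ l) (sym c₀≡0)) c₀+l≡0)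
      side₁-rel : lc (coeffs₁ c) b₁ ≗ 0ᵥ
      side₁-rel y = drop-c₀ (side₁≡0 y)
      side₂-rel : lc (coeffs₂ c) b₂ ≗ 0ᵥ
      side₂-rel = punchIn-elim v (lc-zeroʳ (coeffs₂ c) {b₂} {v} (proj₂ ∘ members B₂))
                                 (λ b → drop-c₀ (trans (sym (lc-side₂ c (punchIn v b))) (proj₂ sides≡0 b)))

    spanning′ : Spans (InKernel (netLap Γ)) basis
    spanning′ x x∈ker = co , λ y → begin
      x y                                   ≡⟨ glue-restrict x y ⟨
      glue (restrict₁ x) (restrict₂ x) y    ≡⟨ glue-cong side₁-fits side₂-fits y ⟩
      glue (lc co side₁) (lc co side₂) y    ≡⟨ lc-glue co side₁ side₂ y ⟨
      lc co basis y                         ∎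
      where
      x₀ = restrict₁ x u
      expansion₁ = spanning B₁ _ (shift-into-section Γ₁ {restrict₁ x} u (proj₁ (restrict-∈-ker {x} x∈ker)))
      expansion₂ = spanning B₂ _ (shift-into-section Γ₂ {restrict₂ x} v (proj₂ (restrict-∈-ker {x} x∈ker)))
      α = proj₁ expansion₁
      β = proj₁ expansion₂
      co : Fin (suc (k₁ + k₂)) → ℚ
      co = x₀ ∷ (α ++ β)
      unshift : ∀ c y → c +ℚ (y -ℚ c *ℚ 1ℚ) ≡ y
      unshift = solve-∀ ℚ-ring
      side₁-fits : restrict₁ x ≗ lc co side₁
      side₁-fits w = begin
        restrict₁ x w                         ≡⟨ unshift x₀ (restrict₁ x w) ⟨
        x₀ +ℚ (restrict₁ x w -ℚ x₀ *ℚ 1ℚ)     ≡⟨ cong (x₀ +ℚ_) (proj₂ expansion₁ w) ⟩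
        x₀ +ℚ lc α b₁ w                       ≡⟨ cong (x₀ +ℚ_) (lc-cong b₁ (λ a → sym (lookup-++ˡ α β a)) w) ⟩
        x₀ +ℚ lc (coeffs₁ co) b₁ w            ≡⟨ lc-side₁ co w ⟨
        lc co side₁ w                         ∎
      side₂-fits : restrict₂ x ≗ lc co side₂
      side₂-fits w = begin
        restrict₂ x w                         ≡⟨ unshift x₀′ (restrict₂ x w) ⟨
        x₀′ +ℚ (restrict₂ x w -ℚ x₀′ *ℚ 1ℚ)   ≡⟨ cong₂ _+ℚ_ (sym (restrict-agree x)) (proj₂ expansion₂ w) ⟩
        x₀ +ℚ lc β b₂ w                       ≡⟨ cong (x₀ +ℚ_) (lc-cong b₂ (λ b → sym (lookup-++ʳ α β b)) w) ⟩
        x₀ +ℚ lc (coeffs₂ co) b₂ w            ≡⟨ lc-side₂ co w ⟨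
        lc co side₂ w                         ∎
        where
        x₀′ = restrict₂ x v

    isBasis : IsBasis (InKernel (netLap Γ)) basis
    isBasis = record { members = members′ ; independent = independent′ ; spanning = spanning′ }

kernel-section-basis : ∀ {n k} (Γ : SignedGraph (suc n)) (w : Fin (suc n)) → η≡ Γ k →
                       Σ ℕ λ k′ → k ≡ suc k′ × Basis (Section Γ w) k′
kernel-section-basis {n} {k} Γ w η≡k = cut (basis-headed-by w (proj₂ (dim⇒basis η≡k)) (netLap-ones Γ) 1≢0)
  where
  cut : (Σ ℕ λ k′ → k ≡ suc k′ × Σ (Fin k′ → Fin (suc n) → ℚ) (IsBasis (InKernel (netLap Γ)) ∘ (1ᵥ ∷_))) →
        Σ ℕ λ k′ → k ≡ suc k′ × Basis (Section Γ w) k′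
  cut (k′ , k≡1+k′ , _ , B) = k′ , k≡1+k′ , _ , hyperplane-section {M = netLap Γ} w refl B

lemma3p4 : ∀ {m n : ℕ} (Γ₁ : SignedGraph (suc m)) (u : Fin (suc m))
             (Γ₂ : SignedGraph (suc n)) (v : Fin (suc n)) (k₁ k₂ : ℕ) →
           η≡ Γ₁ k₁ → η≡ Γ₂ k₂ →
           η≡ (coalescence Γ₁ u Γ₂ v) (k₁ + k₂ ∸ 1)
lemma3p4 Γ₁ u Γ₂ v k₁ k₂ η₁ η₂ = glue-sections (kernel-section-basis Γ₁ u η₁) (kernel-section-basis Γ₂ v η₂)
  where
  glue-sections : ∀ {k₁ k₂} → Σ ℕ (λ k₁′ → k₁ ≡ suc k₁′ × Basis (Section Γ₁ u) k₁′) →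
                  Σ ℕ (λ k₂′ → k₂ ≡ suc k₂′ × Basis (Section Γ₂ v) k₂′) →
                  η≡ (coalescence Γ₁ u Γ₂ v) (k₁ + k₂ ∸ 1)
  glue-sections (k₁′ , refl , _ , B₁) (k₂′ , refl , _ , B₂) =
    subst (η≡ (coalescence Γ₁ u Γ₂ v)) (sym (ℕ.+-suc k₁′ k₂′))
          (basis⇒dim (_ , Coalescence.GluedBasis.isBasis Γ₁ u Γ₂ v B₁ B₂))
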